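{- For all $\mu$-calculus formulas $\varphi$ and all downward-closed valuations $\mathcal{E}$ in the lattice of subsets, the set $[\![\varphi]\!]^{\mathcal{S}}_{\mathcal{E}}$ is downward closed.
   Context: Fix a game structure $G=\langle L,l_0,\Sigma,\Delta,\mathcal{O},\gamma\rangle$: $L$ finite states, $\Sigma$ finite alphabet, $\Delta\subseteq L\times\Sigma\times L$ total, $\mathcal{O}$ finite observations, $\gamma:\mathcal{O}\to2^L\setminus\{\emptyset\}$ with $\{\gamma(o)\}$ a partition of $L$; $\mathsf{Post}_\sigma(s)=\{\ell'\mid\exists\ell\in s:(\ell,\sigma,\ell')\in\Delta\}$. Let $\mathcal{L}=2^L\setminus\{\emptyset\}$ and $(s_1,\sigma,s_2)\in\Delta^K$ iff $s_2=\mathsf{Post}_\sigma(s_1)\cap\gamma(o)\neq\emptyset$ for some $o\in\mathcal{O}$. Lattice of subsets: $\mathcal{S}=2^{\mathcal{L}}$ under $\subseteq$, with $\mathsf{CPre}(q)=\{s\in\mathcal{L}\mid\exists\sigma\in\Sigma\,\forall s'\in\mathcal{L}:(s,\sigma,s')\in\Delta^K\Rightarrow s'\in q\}$. The downward closure of $q\in\mathcal{S}$ is $\downarrow q=\{s\in\mathcal{L}\mid\exists s'\in q:s\subseteq s'\}$; $q$ is downward closed if $q=\downarrow q$; a valuation $\mathcal{E}$ (mapping variables to elements of $\mathcal{S}$) is downward closed if each $\mathcal{E}(x)$ is. $\mu$-calculus formulas: $\varphi::=o\mid x\mid\varphi\lor\varphi\mid\varphi\land\varphi\mid\mathsf{pre}(\varphi)\mid\mu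 x.\varphi\mid\nu x.\varphi$ with $o\in\mathcal{O}$. Semantics: $[\![o]\!]^{\mathcal{S}}_{\mathcal{E}}=\{s\in\mathcal{L}\mid s\subseteq\gamma(o)\}$, $[\![x]\!]^{\mathcal{S}}_{\mathcal{E}}=\mathcal{E}(x)$, $\lor,\land$ are $\cup,\cap$, $[\![\mathsf{pre}(\varphi)]\!]=\mathsf{CPre}([\![\varphi]\!])$, $[\![\mu x.\varphi]\!]_{\mathcal{E}}=\bigcap\{q\mid q=[\![\varphi]\!]_{\mathcal{E}[x\mapsto q]}\}$, $[\![\nu x.\varphi]\!]_{\mathcal{E}}=\bigcup\{q\mid q=[\![\varphi]\!]_{\mathcal{E}[x\mapsto q]}\}$, where $\mathcal{E}[x\mapsto q]$ agrees with $\mathcal{E}$ except mapping $x$ to $q$. -}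

module Defs where

open import Data.Nat using (ℕ; zero; suc)
open import Data.Bool using (Bool; true; false; _∧_; _∨_; not; if_then_else_)
import Data.Bool.Properties as BoolP
open import Data.Fin using (Fin)
open import Data.Fin.Subset using (Subset; _∈_; _⊆_; _∩_; Nonempty)
open import Data.Fin.Subset.Properties using (nonempty?; _⊆?_)
open import Data.Vec using (Vec; []; _∷_; tabulate; lookup)
open import Data.Vec.Properties using (≡-dec)
open import Data.Product using (∃; ∃!)
open import Relation.Binary.PropositionalEquality using (_≡_)
open import Relation.Nullary using (does)

someFin : ∀ {n} → (Fin n → Bool) → Bool
someFin {zero}  p = false
someFin {suc n} p = p Fin.zero ∨ someFin (λ i → p (Fin.suc i))

allSub : (n : ℕ) → (Subset n → Bool) → Bool
allSub zero    p = p []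
allSub (suc n) p = allSub n (λ v → p (true ∷ v)) ∧ allSub n (λ v → p (false ∷ v))

-- predicates on subsets of L; an element q of 𝓢 = 2^𝓛 is represented by
-- its characteristic function, whose value on ∅ (∉ 𝓛) is ignored
Pred : ℕ → Set
Pred n = Subset n → Bool

allPred : (n : ℕ) → (Pred n → Bool) → Bool
allPred zero    P = P (λ _ → true) ∧ P (λ _ → false)
allPred (suc n) P =
  allPred n (λ f → allPred n (λ g → P (λ { (true ∷ v) → f v ; (false ∷ v) → g v })))

somePred : (n : ℕ) → (Pred n → Bool) → Bool
somePred n P = not (allPred n (λ q → not (P q)))

-- Game structures  G = ⟨L, l₀, Σ, Δ, 𝒪, γ⟩ with L = Fin n, Σ = Fin k, 𝒪 = Fin m

record Game : Set where
  field
    n k m     : ℕ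
    l₀        : Fin n
    Δ         : Fin n → Fin k → Fin n → Bool
    Δ-total   : ∀ l σ → ∃ λ l′ → Δ l σ l′ ≡ true
    γ         : Fin m → Subset n
    γ-nonempty : ∀ o → Nonempty (γ o)
    γ-partition : ∀ l → ∃! _≡_ (λ o → l ∈ γ o)

data Formula (m : ℕ) : Set where
  obs  : Fin m → Formula m
  var  : ℕ → Formula m
  _∨ᶠ_ : Formula m → Formula m → Formula m
  _∧ᶠ_ : Formula m → Formula m → Formula m
  pre  : Formula m → Formula m
  μ    : ℕ → Formula m → Formula m
  ν    : ℕ → Formula m → Formula m

module Sem (G : Game) where
  open Game G

  nonemptyᵇ : Subset n → Bool
  nonemptyᵇ s = does (nonempty? s)

  Post : Fin k → Subset n → Subset n
  Post σ s = tabulate (λ l′ → someFin (λ l → lookup s l ∧ Δ l σ l′))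

  ΔK : Subset n → Fin k → Subset n → Bool
  ΔK s₁ σ s₂ = someFin (λ o →
    does (≡-dec BoolP._≟_ s₂ (Post σ s₁ ∩ γ o)) ∧ nonemptyᵇ s₂)

  CPre : Pred n → Pred n
  CPre q s = nonemptyᵇ s ∧ someFin (λ σ →
    allSub n (λ s′ → not (nonemptyᵇ s′) ∨ not (ΔK s σ s′) ∨ q s′))

  Env : Set
  Env = ℕ → Pred n

  _[_↦_] : Env → ℕ → Pred n → Env
  (E [ x ↦ q ]) y = if does (x Data.Nat.≟ y) then q else E y

  -- q = q′ as elements of 𝓢 = 2^𝓛 (agreement on nonempty subsets)
  sameᵇ : Pred n → Pred n → Bool
  sameᵇ q q′ = allSub n (λ s → not (nonemptyᵇ s) ∨ does (BoolP._≟_ (q s) (q′ s)))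

  -- semantics ⟦φ⟧^𝓢_E, as a characteristic function on 𝓛 (false on ∅)
  ⟦_⟧ : Formula m → Env → Pred n
  ⟦ obs o ⟧   E s = nonemptyᵇ s ∧ does (s ⊆? γ o)
  ⟦ var x ⟧   E s = nonemptyᵇ s ∧ E x s
  ⟦ φ ∨ᶠ ψ ⟧ E s = ⟦ φ ⟧ E s ∨ ⟦ ψ ⟧ E s
  ⟦ φ ∧ᶠ ψ ⟧ E s = ⟦ φ ⟧ E s ∧ ⟦ ψ ⟧ E s
  ⟦ pre φ ⟧   E s = CPre (⟦ φ ⟧ E) s
  ⟦ μ x φ ⟧   E s = nonemptyᵇ s ∧
    allPred n (λ q → not (sameᵇ q (⟦ φ ⟧ (E [ x ↦ q ]))) ∨ q s)
  ⟦ ν x φ ⟧   E s = nonemptyᵇ s ∧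
    somePred n (λ q → sameᵇ q (⟦ φ ⟧ (E [ x ↦ q ])) ∧ q s)

  DownClosed : Pred n → Set
  DownClosed q = ∀ s s′ → Nonempty s → s ⊆ s′ → q s′ ≡ true → q s ≡ true

  DownClosedEnv : Env → Set
  DownClosedEnv E = ∀ x → DownClosed (E x)

module Submission where

-- By induction on φ, for every downward-closed valuation at once (the fixed-point cases
-- extend the valuation), using that the semantics is monotone in the valuation.
-- Each connective preserves downward closure: CPre does because Post is monotone, so a
-- successor of a smaller knowledge set lies inside the corresponding successor of a larger
-- one.  For the fixed points, the largest downward-closed subset of μF is again a prefixed
-- point of F, hence contains μF; dually the downward closure of νF is a postfixed point,
-- hence is contained in νF.

open import Defs
open import Data.Nat using (ℕ; zero; suc)
import Data.Nat as ℕ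
open import Data.Bool using (Bool; true; false; _∧_; _∨_; not)
open import Data.Bool.Properties using (∧-conicalˡ; ∧-conicalʳ; ∨-zeroʳ; not-injective; not-¬)
import Data.Bool.Properties as Bool
open import Data.Fin using (Fin)
open import Data.Fin.Subset using (Subset; _∈_; _⊆_; _∩_; Nonempty)
open import Data.Fin.Subset.Properties using (nonempty?; _⊆?_; ⊆-refl; ⊆-trans; x∈p∩q⁺; x∈p∩q⁻)
open import Data.Vec using ([]; _∷_)
open import Data.Vec.Properties using (≡-dec; []=⇒lookup; lookup⇒[]=; lookup∘tabulate)
open import Data.Product using (∃; _×_; _,_; map; map₁; map₂)
open import Data.Sum using (_⊎_; inj₁; inj₂)
open import Data.Empty using (⊥-elim)
open import Function using (_∘_; id)
open import Relation.Binary.PropositionalEquality using (_≡_; refl; sym; trans; _≗_)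
open import Relation.Nullary using (Dec; yes; does)
open import Relation.Nullary.Decidable using (dec-true)

∧-true : ∀ {a b} → a ≡ true → b ≡ true → a ∧ b ≡ true
∧-true refl refl = refl

∨-trueˡ : ∀ {a} b → a ≡ true → a ∨ b ≡ true
∨-trueˡ b refl = refl

∨-trueʳ : ∀ a {b} → b ≡ true → a ∨ b ≡ true
∨-trueʳ a refl = ∨-zeroʳ a

∨-true⁻ : ∀ a {b} → a ∨ b ≡ true → a ≡ true ⊎ b ≡ true
∨-true⁻ true  _ = inj₁ refl
∨-true⁻ false h = inj₂ h

infixr 5 _⇒ᵇ_

_⇒ᵇ_ : Bool → Bool → Bool
a ⇒ᵇ b = not a ∨ b

⇒ᵇ-true⁺ : ∀ a {b} → (a ≡ true → b ≡ true) → a ⇒ᵇ b ≡ true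
⇒ᵇ-true⁺ true  f = f refl
⇒ᵇ-true⁺ false f = refl

⇒ᵇ-true⁻ : ∀ a {b} → a ⇒ᵇ b ≡ true → a ≡ true → b ≡ true
⇒ᵇ-true⁻ true h refl = h

≡-from-true⇔ : ∀ {a b} → (a ≡ true → b ≡ true) → (b ≡ true → a ≡ true) → a ≡ b
≡-from-true⇔ {true}  f g = sym (f refl)
≡-from-true⇔ {false} {true}  f g = g refl
≡-from-true⇔ {false} {false} f g = refl

does-true⇒ : ∀ {p} {P : Set p} (P? : Dec P) → does P? ≡ true → P
does-true⇒ (yes p) _ = p

someFin⁺ : ∀ {n} (p : Fin n → Bool) i → p i ≡ true → someFin p ≡ true
someFin⁺ p Fin.zero    h = ∨-trueˡ _ h
someFin⁺ p (Fin.suc i) h = ∨-trueʳ (p Fin.zero) (someFin⁺ (p ∘ Fin.suc) i h)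

someFin⁻ : ∀ {n} (p : Fin n → Bool) → someFin p ≡ true → ∃ λ i → p i ≡ true
someFin⁻ {suc n} p h with ∨-true⁻ (p Fin.zero) h
... | inj₁ p0 = Fin.zero , p0
... | inj₂ ps = map Fin.suc id (someFin⁻ (p ∘ Fin.suc) ps)

allSub⁺ : ∀ n (p : Subset n → Bool) → (∀ s → p s ≡ true) → allSub n p ≡ true
allSub⁺ zero    p f = f []
allSub⁺ (suc n) p f = ∧-true (allSub⁺ n _ (f ∘ (true ∷_))) (allSub⁺ n _ (f ∘ (false ∷_)))

allSub⁻ : ∀ n (p : Subset n → Bool) → allSub n p ≡ true → ∀ s → p s ≡ true
allSub⁻ zero    p h []          = h
allSub⁻ (suc n) p h (true ∷ s)  = allSub⁻ n _ (∧-conicalˡ _ _ h) s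
allSub⁻ (suc n) p h (false ∷ s) = allSub⁻ n _ (∧-conicalʳ _ _ h) s

someSub : (n : ℕ) → (Subset n → Bool) → Bool
someSub zero    p = p []
someSub (suc n) p = someSub n (λ v → p (true ∷ v)) ∨ someSub n (λ v → p (false ∷ v))

someSub⁺ : ∀ n (p : Subset n → Bool) s → p s ≡ true → someSub n p ≡ true
someSub⁺ zero    p []          h = h
someSub⁺ (suc n) p (true ∷ s)  h = ∨-trueˡ _ (someSub⁺ n _ s h)
someSub⁺ (suc n) p (false ∷ s) h = ∨-trueʳ (someSub n _) (someSub⁺ n _ s h)

someSub⁻ : ∀ n (p : Subset n → Bool) → someSub n p ≡ true → ∃ λ s → p s ≡ true
someSub⁻ zero    p h = [] , h
someSub⁻ (suc n) p h with ∨-true⁻ (someSub n _) h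
... | inj₁ h₁ = map (true ∷_) id (someSub⁻ n _ h₁)
... | inj₂ h₂ = map (false ∷_) id (someSub⁻ n _ h₂)

allPred⁺ : ∀ n (P : Pred n → Bool) → (∀ q → P q ≡ true) → allPred n P ≡ true
allPred⁺ zero    P f = ∧-true (f _) (f _)
allPred⁺ (suc n) P f = allPred⁺ n _ (λ _ → allPred⁺ n _ (λ _ → f _))

-- allPred only visits the characteristic functions it builds by pattern matching, so the
-- instance it provides for q agrees with q pointwise but not definitionally.
allPred⁻ : ∀ n (P : Pred n → Bool) → allPred n P ≡ true →
           ∀ q → ∃ λ q′ → q′ ≗ q × P q′ ≡ true
allPred⁻ zero P h q with q [] in q[]
... | true  = _ , (λ { [] → sym q[] }) , ∧-conicalˡ _ _ h
... | false = _ , (λ { [] → sym q[] }) , ∧-conicalʳ _ _ h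
allPred⁻ (suc n) P h q with allPred⁻ n _ h (q ∘ (true ∷_))
... | f , f≗ , h₁ with allPred⁻ n _ h₁ (q ∘ (false ∷_))
... | g , g≗ , h₂ = _ , (λ { (true ∷ v) → f≗ v ; (false ∷ v) → g≗ v }) , h₂

allPred-false⁻ : ∀ n (P : Pred n → Bool) → allPred n P ≡ false → ∃ λ q → P q ≡ false
allPred-false⁻ zero P h with P (λ _ → true) in Ptrue
... | true  = (λ _ → false) , h
... | false = _ , Ptrue
allPred-false⁻ (suc n) P h with allPred-false⁻ n _ h
... | _ , h₁ with allPred-false⁻ n _ h₁
... | _ , h₂ = _ , h₂

somePred⁺ : ∀ n (P : Pred n → Bool) q → (∀ q′ → q′ ≗ q → P q′ ≡ true) → somePred n P ≡ true
somePred⁺ n P q f with allPred n (not ∘ P) in all¬P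
... | false = refl
... | true with allPred⁻ n _ all¬P q
... | q′ , q′≗q , ¬Pq′ = ⊥-elim (not-¬ (f q′ q′≗q) (not-injective {y = false} ¬Pq′))

somePred⁻ : ∀ n (P : Pred n → Bool) → somePred n P ≡ true → ∃ λ q → P q ≡ true
somePred⁻ n P h with allPred-false⁻ n _ (not-injective h)
... | q , ¬Pq = q , not-injective ¬Pq

module DownwardClosure (G : Game) where
  open Game G
  open Sem G

  nonemptyᵇ-complete : ∀ {s} → Nonempty s → nonemptyᵇ s ≡ true
  nonemptyᵇ-complete {s} = dec-true (nonempty? s)

  nonemptyᵇ-sound : ∀ {s} → nonemptyᵇ s ≡ true → Nonempty s
  nonemptyᵇ-sound {s} = does-true⇒ (nonempty? s)

  allNonempty : (Subset n → Bool) → Bool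
  allNonempty p = allSub n (λ s → nonemptyᵇ s ⇒ᵇ p s)

  allNonempty⁺ : ∀ p → (∀ s → Nonempty s → p s ≡ true) → allNonempty p ≡ true
  allNonempty⁺ p f = allSub⁺ n _ λ s → ⇒ᵇ-true⁺ (nonemptyᵇ s) (f s ∘ nonemptyᵇ-sound)

  allNonempty⁻ : ∀ p → allNonempty p ≡ true → ∀ s → Nonempty s → p s ≡ true
  allNonempty⁻ p h s ne = ⇒ᵇ-true⁻ (nonemptyᵇ s) (allSub⁻ n _ h s) (nonemptyᵇ-complete ne)

  infix 4 _⊑_ _⊑ₑ_
  infix 7 _⊑ᵇ_

  _⊑_ : Pred n → Pred n → Set
  q ⊑ q′ = ∀ s → Nonempty s → q s ≡ true → q′ s ≡ true

  ⊑-refl : ∀ {q} → q ⊑ q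
  ⊑-refl s ne h = h

  ⊑-trans : ∀ {q q′ q″} → q ⊑ q′ → q′ ⊑ q″ → q ⊑ q″
  ⊑-trans q⊑q′ q′⊑q″ s ne = q′⊑q″ s ne ∘ q⊑q′ s ne

  ≗⇒⊑ : ∀ {q q′} → q ≗ q′ → q ⊑ q′
  ≗⇒⊑ q≗q′ s ne h = trans (sym (q≗q′ s)) h

  _⊑ᵇ_ : Pred n → Pred n → Bool
  q ⊑ᵇ q′ = allNonempty (λ s → q s ⇒ᵇ q′ s)

  ⊑ᵇ⁺ : ∀ {q q′} → q ⊑ q′ → q ⊑ᵇ q′ ≡ true
  ⊑ᵇ⁺ {q} q⊑q′ = allNonempty⁺ _ λ s ne → ⇒ᵇ-true⁺ (q s) (q⊑q′ s ne)

  ⊑ᵇ⁻ : ∀ {q q′} → q ⊑ᵇ q′ ≡ true → q ⊑ q′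
  ⊑ᵇ⁻ {q} h s ne = ⇒ᵇ-true⁻ (q s) (allNonempty⁻ _ h s ne)

  sameᵇ⁺ : ∀ {q q′} → q ⊑ q′ → q′ ⊑ q → sameᵇ q q′ ≡ true
  sameᵇ⁺ {q} {q′} q⊑q′ q′⊑q = allNonempty⁺ _ λ s ne →
    dec-true (q s Bool.≟ q′ s) (≡-from-true⇔ (q⊑q′ s ne) (q′⊑q s ne))

  sameᵇ-≡ : ∀ {q q′} → sameᵇ q q′ ≡ true → ∀ s → Nonempty s → q s ≡ q′ s
  sameᵇ-≡ {q} {q′} h s ne = does-true⇒ (q s Bool.≟ q′ s) (allNonempty⁻ _ h s ne)

  sameᵇ⇒⊑ : ∀ {q q′} → sameᵇ q q′ ≡ true → q ⊑ q′
  sameᵇ⇒⊑ {q} {q′} h s ne qs = trans (sym (sameᵇ-≡ {q} {q′} h s ne)) qs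

  sameᵇ⇒⊒ : ∀ {q q′} → sameᵇ q q′ ≡ true → q′ ⊑ q
  sameᵇ⇒⊒ {q} {q′} h s ne q′s = trans (sameᵇ-≡ {q} {q′} h s ne) q′s

  Monotonic : (Pred n → Pred n) → Set
  Monotonic F = ∀ {q q′} → q ⊑ q′ → F q ⊑ F q′

  -- lfp (λ q → ⟦ φ ⟧ (E [ x ↦ q ])) is definitionally ⟦ μ x φ ⟧ E, and likewise for gfp and ν.
  lfp gfp : (Pred n → Pred n) → Pred n
  lfp F s = nonemptyᵇ s ∧ allPred n (λ q → sameᵇ q (F q) ⇒ᵇ q s)
  gfp F s = nonemptyᵇ s ∧ somePred n (λ q → sameᵇ q (F q) ∧ q s)

  -- Both only quantify over fixed points, so Knaster–Tarski has to supply the fixed points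
  -- ⋂prefixed and ⋃postfixed that identify them as the least and greatest ones.
  module _ {F : Pred n → Pred n} (F-mono : Monotonic F) where

    ⋂prefixed : Pred n
    ⋂prefixed s = allPred n (λ q → F q ⊑ᵇ q ⇒ᵇ q s)

    ⋂prefixed-lowerBound : ∀ {q} → F q ⊑ q → ⋂prefixed ⊑ q
    ⋂prefixed-lowerBound {q} Fq⊑q s ne h with allPred⁻ n _ h q
    ... | q′ , q′≗q , r = ≗⇒⊑ q′≗q s ne (⇒ᵇ-true⁻ (F q′ ⊑ᵇ q′) r (⊑ᵇ⁺ Fq′⊑q′))
      where
      Fq′⊑q′ : F q′ ⊑ q′
      Fq′⊑q′ = ⊑-trans (F-mono (≗⇒⊑ q′≗q)) (⊑-trans Fq⊑q (≗⇒⊑ (sym ∘ q′≗q)))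

    ⋂prefixed-prefixed : F ⋂prefixed ⊑ ⋂prefixed
    ⋂prefixed-prefixed s ne h = allPred⁺ n _ λ q → ⇒ᵇ-true⁺ (F q ⊑ᵇ q) λ Fq⊑ᵇq →
      ⊑ᵇ⁻ {F q} Fq⊑ᵇq s ne (F-mono (⋂prefixed-lowerBound (⊑ᵇ⁻ {F q} Fq⊑ᵇq)) s ne h)

    lfp⊑⋂prefixed : lfp F ⊑ ⋂prefixed
    lfp⊑⋂prefixed s ne h with allPred⁻ n _ (∧-conicalʳ _ _ h) ⋂prefixed
    ... | q′ , q′≗⋂ , r = ≗⇒⊑ q′≗⋂ s ne (⇒ᵇ-true⁻ (sameᵇ q′ (F q′)) r (sameᵇ⁺ q′⊑Fq′ Fq′⊑q′))
      where
      q′⊑Fq′ : q′ ⊑ F q′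
      q′⊑Fq′ = ⊑-trans (≗⇒⊑ q′≗⋂)
        (⊑-trans (⋂prefixed-lowerBound (F-mono ⋂prefixed-prefixed)) (F-mono (≗⇒⊑ (sym ∘ q′≗⋂))))
      Fq′⊑q′ : F q′ ⊑ q′
      Fq′⊑q′ = ⊑-trans (F-mono (≗⇒⊑ q′≗⋂)) (⊑-trans ⋂prefixed-prefixed (≗⇒⊑ (sym ∘ q′≗⋂)))

    lfp-least : ∀ {q} → F q ⊑ q → lfp F ⊑ q
    lfp-least = ⊑-trans lfp⊑⋂prefixed ∘ ⋂prefixed-lowerBound

    lfp-prefixed : F (lfp F) ⊑ lfp F
    lfp-prefixed = ⊑-trans (F-mono lfp⊑⋂prefixed) (⊑-trans ⋂prefixed-prefixed ⋂prefixed⊑lfp)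
      where
      ⋂prefixed⊑lfp : ⋂prefixed ⊑ lfp F
      ⋂prefixed⊑lfp s ne h = ∧-true (nonemptyᵇ-complete ne) (allPred⁺ n _ λ q →
        ⇒ᵇ-true⁺ (sameᵇ q (F q)) λ q≈Fq → ⋂prefixed-lowerBound (sameᵇ⇒⊒ {q} q≈Fq) s ne h)

    ⋃postfixed : Pred n
    ⋃postfixed s = somePred n (λ q → q ⊑ᵇ F q ∧ q s)

    ⋃postfixed-upperBound : ∀ {q} → q ⊑ F q → q ⊑ ⋃postfixed
    ⋃postfixed-upperBound {q} q⊑Fq s ne h = somePred⁺ n _ q λ q′ q′≗q →
      ∧-true (⊑ᵇ⁺ (⊑-trans (≗⇒⊑ q′≗q) (⊑-trans q⊑Fq (F-mono (≗⇒⊑ (sym ∘ q′≗q))))))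
             (trans (q′≗q s) h)

    ⋃postfixed-postfixed : ⋃postfixed ⊑ F ⋃postfixed
    ⋃postfixed-postfixed s ne h with somePred⁻ n _ h
    ... | q , r = F-mono (⋃postfixed-upperBound q⊑Fq) s ne (q⊑Fq s ne (∧-conicalʳ _ _ r))
      where
      q⊑Fq : q ⊑ F q
      q⊑Fq = ⊑ᵇ⁻ (∧-conicalˡ _ _ r)

    gfp⊑⋃postfixed : gfp F ⊑ ⋃postfixed
    gfp⊑⋃postfixed s ne h with somePred⁻ n _ (∧-conicalʳ _ _ h)
    ... | q , r = ⋃postfixed-upperBound (sameᵇ⇒⊑ {q} (∧-conicalˡ _ _ r)) s ne (∧-conicalʳ _ _ r)

    ⋃postfixed⊑gfp : ⋃postfixed ⊑ gfp F
    ⋃postfixed⊑gfp s ne h = ∧-true (nonemptyᵇ-complete ne) (somePred⁺ n _ ⋃postfixed λ q′ q′≗⋃ →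
      ∧-true (sameᵇ⁺ (q′⊑Fq′ q′≗⋃) (Fq′⊑q′ q′≗⋃)) (trans (q′≗⋃ s) h))
      where
      q′⊑Fq′ : ∀ {q′} → q′ ≗ ⋃postfixed → q′ ⊑ F q′
      q′⊑Fq′ q′≗⋃ = ⊑-trans (≗⇒⊑ q′≗⋃) (⊑-trans ⋃postfixed-postfixed (F-mono (≗⇒⊑ (sym ∘ q′≗⋃))))
      Fq′⊑q′ : ∀ {q′} → q′ ≗ ⋃postfixed → F q′ ⊑ q′
      Fq′⊑q′ q′≗⋃ = ⊑-trans (F-mono (≗⇒⊑ q′≗⋃))
        (⊑-trans (⋃postfixed-upperBound (F-mono ⋃postfixed-postfixed)) (≗⇒⊑ (sym ∘ q′≗⋃)))

    gfp-greatest : ∀ {q} → q ⊑ F q → q ⊑ gfp F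
    gfp-greatest = (λ q⊑⋃ → ⊑-trans q⊑⋃ ⋃postfixed⊑gfp) ∘ ⋃postfixed-upperBound

    gfp-postfixed : gfp F ⊑ F (gfp F)
    gfp-postfixed = ⊑-trans gfp⊑⋃postfixed (⊑-trans ⋃postfixed-postfixed (F-mono ⋃postfixed⊑gfp))

  downClosure : Pred n → Pred n
  downClosure p s = someSub n (λ t → does (s ⊆? t) ∧ p t)

  ⊑-downClosure : ∀ {p} → p ⊑ downClosure p
  ⊑-downClosure s ne ps = someSub⁺ n _ s (∧-true (dec-true (s ⊆? s) ⊆-refl) ps)

  downClosure-downClosed : ∀ {p} → DownClosed (downClosure p)
  downClosure-downClosed {p} s s′ ne s⊆s′ h with someSub⁻ n _ h
  ... | t , r = someSub⁺ n _ t
    (∧-true (dec-true (s ⊆? t) (⊆-trans s⊆s′ (does-true⇒ (s′ ⊆? t) (∧-conicalˡ _ _ r))))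
            (∧-conicalʳ _ _ r))

  downClosure-least : ∀ {p q} → DownClosed q → p ⊑ q → downClosure p ⊑ q
  downClosure-least {p} dq p⊑q s ne h with someSub⁻ n _ h
  ... | t , r = dq s t ne s⊆t (p⊑q t (map₂ s⊆t ne) (∧-conicalʳ _ _ r))
    where
    s⊆t : s ⊆ t
    s⊆t = does-true⇒ (s ⊆? t) (∧-conicalˡ _ _ r)

  downClosed-from-downClosure⊑ : ∀ {p} → downClosure p ⊑ p → DownClosed p
  downClosed-from-downClosure⊑ ↓p⊑p s s′ ne s⊆s′ ps′ =
    ↓p⊑p s ne (someSub⁺ n _ s′ (∧-true (dec-true (s ⊆? s′) s⊆s′) ps′))

  downInterior : Pred n → Pred n
  downInterior p s = allNonempty (λ t → does (t ⊆? s) ⇒ᵇ p t)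

  downInterior-⊑ : ∀ {p} → downInterior p ⊑ p
  downInterior-⊑ s ne h = ⇒ᵇ-true⁻ (does (s ⊆? s)) (allNonempty⁻ _ h s ne) (dec-true (s ⊆? s) ⊆-refl)

  downInterior-downClosed : ∀ {p} → DownClosed (downInterior p)
  downInterior-downClosed s s′ ne s⊆s′ h = allNonempty⁺ _ λ t ne-t →
    ⇒ᵇ-true⁺ (does (t ⊆? s)) λ t⊆ᵇs →
      ⇒ᵇ-true⁻ (does (t ⊆? s′)) (allNonempty⁻ _ h t ne-t)
        (dec-true (t ⊆? s′) (⊆-trans (does-true⇒ (t ⊆? s) t⊆ᵇs) s⊆s′))

  downInterior-greatest : ∀ {p q} → DownClosed q → q ⊑ p → q ⊑ downInterior p
  downInterior-greatest dq q⊑p s ne qs = allNonempty⁺ _ λ t ne-t →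
    ⇒ᵇ-true⁺ (does (t ⊆? s)) λ t⊆ᵇs →
      q⊑p t ne-t (dq t s ne-t (does-true⇒ (t ⊆? s) t⊆ᵇs) qs)

  downClosed-from-⊑downInterior : ∀ {p} → p ⊑ downInterior p → DownClosed p
  downClosed-from-⊑downInterior {p} p⊑int s s′ ne s⊆s′ ps′ =
    ⇒ᵇ-true⁻ (does (s ⊆? s′)) (allNonempty⁻ _ (p⊑int s′ (map₂ s⊆s′ ne) ps′) s ne)
      (dec-true (s ⊆? s′) s⊆s′)

  PreservesDownClosed : (Pred n → Pred n) → Set
  PreservesDownClosed F = ∀ {q} → DownClosed q → DownClosed (F q)

  module _ {F : Pred n → Pred n} (F-mono : Monotonic F) (F-dc : PreservesDownClosed F) where

    lfp-downClosed : DownClosed (lfp F)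
    lfp-downClosed = downClosed-from-⊑downInterior (lfp-least F-mono
      (downInterior-greatest (F-dc downInterior-downClosed)
        (⊑-trans (F-mono downInterior-⊑) (lfp-prefixed F-mono))))

    gfp-downClosed : DownClosed (gfp F)
    gfp-downClosed = downClosed-from-downClosure⊑ (gfp-greatest F-mono
      (downClosure-least (F-dc downClosure-downClosed)
        (⊑-trans (gfp-postfixed F-mono) (F-mono ⊑-downClosure))))

  ∈Post⁺ : ∀ {σ s l l′} → l ∈ s → Δ l σ l′ ≡ true → l′ ∈ Post σ s
  ∈Post⁺ {σ} {s} {l} {l′} l∈s δ = lookup⇒[]= l′ (Post σ s)
    (trans (lookup∘tabulate _ l′) (someFin⁺ _ l (∧-true ([]=⇒lookup l∈s) δ)))

  ∈Post⁻ : ∀ {σ s l′} → l′ ∈ Post σ s → ∃ λ l → l ∈ s × Δ l σ l′ ≡ true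
  ∈Post⁻ {σ} {s} {l′} l′∈ with someFin⁻ _ (trans (sym (lookup∘tabulate _ l′)) ([]=⇒lookup l′∈))
  ... | l , r = l , lookup⇒[]= l s (∧-conicalˡ _ _ r) , ∧-conicalʳ _ _ r

  Post-mono : ∀ σ {s s′} → s ⊆ s′ → Post σ s ⊆ Post σ s′
  Post-mono σ s⊆s′ l′∈ with ∈Post⁻ l′∈
  ... | l , l∈s , δ = ∈Post⁺ (s⊆s′ l∈s) δ

  ΔK⁺ : ∀ {s σ} o → Nonempty (Post σ s ∩ γ o) → ΔK s σ (Post σ s ∩ γ o) ≡ true
  ΔK⁺ {s} {σ} o ne = someFin⁺ _ o
    (∧-true (dec-true (≡-dec Bool._≟_ succ succ) refl) (nonemptyᵇ-complete ne))
    where succ = Post σ s ∩ γ o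

  ΔK⁻ : ∀ {s σ t} → ΔK s σ t ≡ true → ∃ λ o → t ≡ Post σ s ∩ γ o
  ΔK⁻ h with someFin⁻ _ h
  ... | o , r = o , does-true⇒ (≡-dec Bool._≟_ _ _) (∧-conicalˡ _ _ r)

  CPre⁺ : ∀ {q s} → Nonempty s →
          (∃ λ σ → ∀ t → Nonempty t → ΔK s σ t ≡ true → q t ≡ true) → CPre q s ≡ true
  CPre⁺ {q} {s} ne (σ , safe) = ∧-true (nonemptyᵇ-complete ne)
    (someFin⁺ _ σ (allNonempty⁺ _ λ t ne-t → ⇒ᵇ-true⁺ (ΔK s σ t) (safe t ne-t)))

  CPre⁻ : ∀ {q s} → CPre q s ≡ true →
          ∃ λ σ → ∀ t → Nonempty t → ΔK s σ t ≡ true → q t ≡ true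
  CPre⁻ {q} {s} h with someFin⁻ _ (∧-conicalʳ _ _ h)
  ... | σ , r = σ , λ t ne-t → ⇒ᵇ-true⁻ (ΔK s σ t) (allNonempty⁻ _ r t ne-t)

  CPre-mono : Monotonic CPre
  CPre-mono q⊑q′ s ne h with CPre⁻ h
  ... | σ , safe = CPre⁺ ne (σ , λ t ne-t → q⊑q′ t ne-t ∘ safe t ne-t)

  CPre-downClosed : PreservesDownClosed CPre
  CPre-downClosed {q} dq s s′ ne s⊆s′ h with CPre⁻ h
  ... | σ , safe′ = CPre⁺ ne (σ , safe)
    where
    safe : ∀ t → Nonempty t → ΔK s σ t ≡ true → q t ≡ true
    safe t ne-t Δt with ΔK⁻ {s} {σ} Δt
    ... | o , refl = dq t t′ ne-t t⊆t′ (safe′ t′ ne-t′ (ΔK⁺ {s′} o ne-t′))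
      where
      t′ = Post σ s′ ∩ γ o
      t⊆t′ : t ⊆ t′
      t⊆t′ = x∈p∩q⁺ ∘ map₁ (Post-mono σ s⊆s′) ∘ x∈p∩q⁻ _ _
      ne-t′ : Nonempty t′
      ne-t′ = map₂ t⊆t′ ne-t

  _⊑ₑ_ : Env → Env → Set
  E ⊑ₑ E′ = ∀ x → E x ⊑ E′ x

  update-⊑ₑ : ∀ {E E′ q q′} x → E ⊑ₑ E′ → q ⊑ q′ → E [ x ↦ q ] ⊑ₑ E′ [ x ↦ q′ ]
  update-⊑ₑ x E⊑E′ q⊑q′ y with does (x ℕ.≟ y)
  ... | true  = q⊑q′
  ... | false = E⊑E′ y

  update-downClosed : ∀ {E q} x → DownClosedEnv E → DownClosed q → DownClosedEnv (E [ x ↦ q ])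
  update-downClosed x dE dq y with does (x ℕ.≟ y)
  ... | true  = dq
  ... | false = dE y

  ⟦⟧-mono : ∀ φ {E E′} → E ⊑ₑ E′ → ⟦ φ ⟧ E ⊑ ⟦ φ ⟧ E′
  ⟦⟧-mono-↦ : ∀ φ x E → Monotonic (λ q → ⟦ φ ⟧ (E [ x ↦ q ]))

  ⟦⟧-mono (obs o)   E⊑E′ = ⊑-refl
  ⟦⟧-mono (var x)   E⊑E′ s ne h = ∧-true (∧-conicalˡ _ _ h) (E⊑E′ x s ne (∧-conicalʳ _ _ h))
  ⟦⟧-mono (φ ∨ᶠ ψ) {E} E⊑E′ s ne h with ∨-true⁻ (⟦ φ ⟧ E s) h
  ... | inj₁ φs = ∨-trueˡ _ (⟦⟧-mono φ E⊑E′ s ne φs)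
  ... | inj₂ ψs = ∨-trueʳ _ (⟦⟧-mono ψ E⊑E′ s ne ψs)
  ⟦⟧-mono (φ ∧ᶠ ψ) E⊑E′ s ne h =
    ∧-true (⟦⟧-mono φ E⊑E′ s ne (∧-conicalˡ _ _ h)) (⟦⟧-mono ψ E⊑E′ s ne (∧-conicalʳ _ _ h))
  ⟦⟧-mono (pre φ)   E⊑E′ = CPre-mono (⟦⟧-mono φ E⊑E′)
  ⟦⟧-mono (μ x φ) {E} {E′} E⊑E′ = lfp-least (⟦⟧-mono-↦ φ x E)
    (⊑-trans (⟦⟧-mono φ (update-⊑ₑ x E⊑E′ ⊑-refl)) (lfp-prefixed (⟦⟧-mono-↦ φ x E′)))
  ⟦⟧-mono (ν x φ) {E} {E′} E⊑E′ = gfp-greatest (⟦⟧-mono-↦ φ x E′)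
    (⊑-trans (gfp-postfixed (⟦⟧-mono-↦ φ x E)) (⟦⟧-mono φ (update-⊑ₑ x E⊑E′ ⊑-refl)))

  ⟦⟧-mono-↦ φ x E q⊑q′ = ⟦⟧-mono φ (update-⊑ₑ x (λ _ → ⊑-refl) q⊑q′)

  ⟦⟧-downClosed : ∀ φ E → DownClosedEnv E → DownClosed (⟦ φ ⟧ E)
  ⟦⟧-downClosed (obs o)   E dE s s′ ne s⊆s′ h = ∧-true (nonemptyᵇ-complete ne)
    (dec-true (s ⊆? γ o) (⊆-trans s⊆s′ (does-true⇒ (s′ ⊆? γ o) (∧-conicalʳ _ _ h))))
  ⟦⟧-downClosed (var x)   E dE s s′ ne s⊆s′ h =
    ∧-true (nonemptyᵇ-complete ne) (dE x s s′ ne s⊆s′ (∧-conicalʳ _ _ h))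
  ⟦⟧-downClosed (φ ∨ᶠ ψ) E dE s s′ ne s⊆s′ h with ∨-true⁻ (⟦ φ ⟧ E s′) h
  ... | inj₁ φs′ = ∨-trueˡ _ (⟦⟧-downClosed φ E dE s s′ ne s⊆s′ φs′)
  ... | inj₂ ψs′ = ∨-trueʳ _ (⟦⟧-downClosed ψ E dE s s′ ne s⊆s′ ψs′)
  ⟦⟧-downClosed (φ ∧ᶠ ψ) E dE s s′ ne s⊆s′ h =
    ∧-true (⟦⟧-downClosed φ E dE s s′ ne s⊆s′ (∧-conicalˡ _ _ h))
           (⟦⟧-downClosed ψ E dE s s′ ne s⊆s′ (∧-conicalʳ _ _ h))
  ⟦⟧-downClosed (pre φ)   E dE = CPre-downClosed (⟦⟧-downClosed φ E dE)
  ⟦⟧-downClosed (μ x φ)   E dE = lfp-downClosed (⟦⟧-mono-↦ φ x E)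
    (λ dq → ⟦⟧-downClosed φ _ (update-downClosed x dE dq))
  ⟦⟧-downClosed (ν x φ)   E dE = gfp-downClosed (⟦⟧-mono-↦ φ x E)
    (λ dq → ⟦⟧-downClosed φ _ (update-downClosed x dE dq))

lemma3p7 : (G : Game) (φ : Formula (Game.m G)) (E : Sem.Env G) →
    Sem.DownClosedEnv G E → Sem.DownClosed G (Sem.⟦_⟧ G φ E)
lemma3p7 G = DownwardClosure.⟦⟧-downClosed G
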